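{- Let $p$ be a prime, $H$ a nonabelian group of order $p^3$, and $G\cong\mathbb{Z}/p\mathbb{Z}\times H$. Then there exist normal subgroups $G^{(1)},G^{(2)}$ of $G$ with $G^{(1)}\cap G^{(2)}$ trivial such that $G^{\mathrm{der}}G^{(1)}\cap G^{\mathrm{der}}G^{(2)}\neq G^{\mathrm{der}}$.
   Context: $G^{\mathrm{der}}$ denotes the commutator subgroup of $G$. (In the paper $G^{(1)},G^{(2)}$ play the role of $\mathrm{Gal}(L/L_1),\mathrm{Gal}(L/L_2)$ for Galois extensions $L_1,L_2$ of a global field with $L$ the Galois closure of $L_1L_2$, which forces them to be normal with trivial intersection.) -}

module Defs where

open import Level using (Level; 0ℓ; _⊔_; suc)
open import Data.Nat using (ℕ)
open import Data.Fin using (Fin)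
open import Data.Integer using (ℤ; +_; _+_; _-_; -_; 0ℤ)
open import Data.Integer.Properties as ℤP using ()
open import Data.Integer.Divisibility.Signed
  using (_∣_; ∣-refl; ∣m∣n⇒∣m+n; ∣m⇒∣-m; ∣m∣n⇒∣m-n)
open import Data.Integer.Tactic.RingSolver using (solve-∀)
open import Data.Product using (Σ; ∃; _×_; _,_)
open import Relation.Nullary using (¬_)
open import Relation.Unary using (Pred)
open import Relation.Binary.PropositionalEquality as ≡ using (_≡_; refl)
open import Algebra.Bundles using (Group; RawGroup)
open import Algebra.Structures using (IsGroup)
import Algebra.Construct.DirectProduct as DP
open import Algebra.Morphism.Structures using (module GroupMorphisms)
open import Function.Bundles using (Inverse)

-- The cyclic group ℤ/nℤ, realised as ℤ under addition with the setoid
-- equality "congruence modulo n" (Agda/stdlib has no quotient types).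

_≡[mod_]_ : ℤ → ℕ → ℤ → Set
x ≡[mod n ] y = (+ n) ∣ (x - y)

private
  x-x≡0 : ∀ x → x - x ≡ 0ℤ
  x-x≡0 = ℤP.+-inverseʳ

  refl-mod : ∀ n {x y} → x ≡ y → x ≡[mod n ] y
  refl-mod n {x} refl rewrite x-x≡0 x = ∣-refl-zero
    where
    ∣-refl-zero : (+ n) ∣ 0ℤ
    ∣-refl-zero = record { quotient = 0ℤ ; equality = refl }

  lem-sym : ∀ x y → y - x ≡ - (x - y)
  lem-sym = solve-∀

  lem-trans : ∀ x y z → x - z ≡ (x - y) + (y - z)
  lem-trans = solve-∀

  lem-plus : ∀ x x' y y' → (x + y) - (x' + y') ≡ (x - x') + (y - y')
  lem-plus = solve-∀

  lem-neg : ∀ x x' → (- x) - (- x') ≡ - (x - x')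
  lem-neg = solve-∀

ℤmod : ℕ → Group 0ℓ 0ℓ
ℤmod n = record
  { Carrier = ℤ
  ; _≈_ = λ x y → x ≡[mod n ] y
  ; _∙_ = _+_
  ; ε = 0ℤ
  ; _⁻¹ = -_
  ; isGroup = record
    { isMonoid = record
      { isSemigroup = record
        { isMagma = record
          { isEquivalence = record
            { refl = λ {x} → refl-mod n {x} refl
            ; sym = λ {x} {y} p → ≡.subst (λ t → (+ n) ∣ t) (≡.sym (lem-sym x y)) (∣m⇒∣-m p)
            ; trans = λ {x} {y} {z} p q →
                ≡.subst (λ t → (+ n) ∣ t) (≡.sym (lem-trans x y z)) (∣m∣n⇒∣m+n p q)
            }
          ; ∙-cong = λ {x} {x'} {y} {y'} p q →
              ≡.subst (λ t → (+ n) ∣ t) (≡.sym (lem-plus x x' y y')) (∣m∣n⇒∣m+n p q)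
          }
        ; assoc = λ x y z → refl-mod n (ℤP.+-assoc x y z)
        }
      ; identity = (λ x → refl-mod n (ℤP.+-identityˡ x))
                 , (λ x → refl-mod n (ℤP.+-identityʳ x))
      }
    ; inverse = (λ x → refl-mod n (ℤP.+-inverseˡ x))
              , (λ x → refl-mod n (ℤP.+-inverseʳ x))
    ; ⁻¹-cong = λ {x} {x'} p →
        ≡.subst (λ t → (+ n) ∣ t) (≡.sym (lem-neg x x')) (∣m⇒∣-m p)
    }
  }

_×ᴳ_ : ∀ {a b ℓ₁ ℓ₂} → Group a ℓ₁ → Group b ℓ₂ → Group (a ⊔ b) (ℓ₁ ⊔ ℓ₂)
_×ᴳ_ = DP.group

_≅ᴳ_ : ∀ {a b ℓ₁ ℓ₂} → Group a ℓ₁ → Group b ℓ₂ → Set (a ⊔ b ⊔ ℓ₁ ⊔ ℓ₂)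
G ≅ᴳ K = Σ (Group.Carrier G → Group.Carrier K)
            (GroupMorphisms.IsGroupIsomorphism (Group.rawGroup G) (Group.rawGroup K))

HasOrder : ∀ {c ℓ} → Group c ℓ → ℕ → Set (c ⊔ ℓ)
HasOrder G n = Inverse (Group.setoid G) (≡.setoid (Fin n))

IsAbelian : ∀ {c ℓ} → Group c ℓ → Set (c ⊔ ℓ)
IsAbelian G = ∀ x y → x ∙ y ≈ y ∙ x
  where open Group G

module _ {c ℓ} (G : Group c ℓ) where
  open Group G

  record IsSubgroup {r} (S : Pred Carrier r) : Set (c ⊔ ℓ ⊔ r) where
    field
      resp  : ∀ {x y} → x ≈ y → S x → S y
      ε∈    : S ε
      ∙∈    : ∀ {x y} → S x → S y → S (x ∙ y)
      ⁻¹∈   : ∀ {x} → S x → S (x ⁻¹)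

  record IsNormalSubgroup {r} (S : Pred Carrier r) : Set (c ⊔ ℓ ⊔ r) where
    field
      isSubgroup : IsSubgroup S
      conj∈      : ∀ g {x} → S x → S ((g ∙ x) ∙ g ⁻¹)

  data Der : Pred Carrier (c ⊔ ℓ) where
    comm : ∀ a b → Der (((a ⁻¹ ∙ b ⁻¹) ∙ a) ∙ b)
    one  : Der ε
    mul  : ∀ {x y} → Der x → Der y → Der (x ∙ y)
    inv  : ∀ {x} → Der x → Der (x ⁻¹)
    resp : ∀ {x y} → x ≈ y → Der x → Der y

  _·_ : ∀ {r s} → Pred Carrier r → Pred Carrier s → Pred Carrier (c ⊔ ℓ ⊔ r ⊔ s)
  (S · T) x = ∃ λ a → ∃ λ b → S a × T b × (x ≈ a ∙ b)

  TrivialIntersection : ∀ {r s} → Pred Carrier r → Pred Carrier s → Set (c ⊔ ℓ ⊔ r ⊔ s)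
  TrivialIntersection S T = ∀ x → S x → T x → x ≈ ε

  SameSubset : ∀ {r s} → Pred Carrier r → Pred Carrier s → Set (c ⊔ r ⊔ s)
  SameSubset S T = ∀ x → (S x → T x) × (T x → S x)

{-# OPTIONS --safe #-}
module Submission where

-- Write G = ℤ/p × H. A nonabelian p-group H has a nontrivial central commutator c = ⁅a,b⁆:
-- H acts by conjugation on the cosets of its centre Z, there are |H : Z| ≡ 0 (mod p) of them,
-- and the number of fixed cosets is ≡ |H : Z| (mod p), so besides Z itself some coset rZ
-- with r ∉ Z is fixed, which makes ⁅g,r⁆ central for every g. Put G¹ = ⟨(1,1)⟩ and
-- G² = ⟨(1,c)⟩: both are cyclic with central generators, hence normal, and they meet
-- trivially because every power c^j = 1 has p ∣ j. The element (1,1) lies in G^der G¹, and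
-- in G^der G² as (0,c)⁻¹(1,c), since (0,c) is a commutator; but it is not in G^der, which
-- the projection to the abelian factor ℤ/p kills.

open import Defs
open import Level using (_⊔_)
open import Data.Nat using (ℕ; _^_)
open import Data.Nat.Primality using (Prime)
open import Data.Product using (Σ; _×_)
open import Relation.Nullary using (¬_)
open import Relation.Unary using (Pred; _∩_)
open import Algebra.Bundles using (Group)

open import Level using (Level; 0ℓ; Lift; lift)
open import Data.Nat using (zero; suc; pred; _+_; _*_; _∸_; _≤_; _<_; z≤n; s≤s; s≤s⁻¹; _%_; _/_; NonZero; NonTrivial; >-nonZero; nonTrivial⇒≢1)
import Data.Nat.Properties as ℕ
open import Data.Nat.Divisibility using (_∣_; divides; _∣0; _∣?_; ∣-trans; ∣1⇒≡1; ∣m∣n⇒∣m+n; ∣m+n∣m⇒∣n; ∣n⇒∣m*n; m∣m*n; m%n≡0⇒n∣m; ∣⇒≤)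
open import Data.Nat.DivMod using (m%n<n; m≡m%n+[m/n]*n)
open import Data.Nat.Coprimality using (Coprime; coprime-divisor)
open import Data.Nat.Primality using (prime⇒irreducible; prime⇒nonZero; prime⇒nonTrivial)
open import Data.Integer using (ℤ; +_; 0ℤ)
import Data.Integer.Properties as ℤ
open import Data.Integer.Divisibility.Signed using (∣⇒∣ᵤ) renaming (_∣_ to _∣ℤ_; ∣-refl to ∣ℤ-refl)
open import Data.Fin using (Fin; _≟_; toℕ; fromℕ<) renaming (zero to fzero; suc to fsuc; _≤_ to _≤ᶠ_)
open import Data.Fin.Properties using (suc-injective; ≤-antisym; all?; any?; ¬∀⟶∃¬; pigeonhole; toℕ<n; toℕ-fromℕ<; toℕ-injective)
open import Data.Fin.Permutation using (permutation)
open import Data.Product using (∃; ∃₂; _,_; proj₁; proj₂)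
open import Data.Sum using (_⊎_; inj₁; inj₂)
open import Data.Empty using (⊥-elim)
open import Function using (_∘_)
open import Function.Bundles using (Inverse)
open import Function.Definitions using (Surjective)
open import Relation.Nullary using (Dec; yes; no; ¬?; _×-dec_; _⊎-dec_)
open import Relation.Unary using (Decidable)
open import Relation.Binary using (Rel; Symmetric; Transitive) renaming (Decidable to Decidable₂)
open import Relation.Binary.Definitions using (tri<; tri≈; tri>)
open import Relation.Binary.PropositionalEquality as ≡ using (_≡_; _≢_)
import Relation.Binary.Reasoning.Setoid as SetoidReasoning
open import Algebra.Bundles using (RawGroup)
open import Algebra.Core using (Op₁; Op₂)
open import Algebra.Structures using (IsGroup)
open import Algebra.Morphism.Structures using (module GroupMorphisms)
import Algebra.Morphism.GroupMonomorphism as GroupMonomorphism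
import Algebra.Definitions.RawMonoid as RawMonoidDefinitions
import Algebra.Properties.Group as GroupProperties
import Algebra.Properties.Monoid.Mult as MonoidMultProperties
open import Algebra.Properties.Semiring.Sum ℕ.+-*-semiring using (sum; sum-syntax; sum-cong-≗; sum-replicate-zero; ∑-comm; ∑-distrib-+; ∑-permute; *-distribˡ-sum; *-distribʳ-sum)

private
  variable
    a b ℓ ℓ′ : Level
    A : Set a
    B : Set b
    m k : ℕ

-- Counting over Fin

module _ where
  open ≡ using (refl; sym; trans; cong; cong₂; module ≡-Reasoning)

  χ : Dec A → ℕ
  χ (yes _) = 1
  χ (no _)  = 0

  χ-yes : (a? : Dec A) → A → χ a? ≡ 1
  χ-yes (yes _) _ = refl
  χ-yes (no ¬a) a = ⊥-elim (¬a a)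

  χ-no : (a? : Dec A) → ¬ A → χ a? ≡ 0
  χ-no (yes a) ¬a = ⊥-elim (¬a a)
  χ-no (no _)  _  = refl

  χ-cong : (a? : Dec A) (b? : Dec B) → (A → B) → (B → A) → χ a? ≡ χ b?
  χ-cong (yes a) b? f g = sym (χ-yes b? (f a))
  χ-cong (no ¬a) b? f g = sym (χ-no b? (¬a ∘ g))

  χ-× : (a? : Dec A) (b? : Dec B) → χ (a? ×-dec b?) ≡ χ a? * χ b?
  χ-× (yes _) (yes _) = refl
  χ-× (yes _) (no _)  = refl
  χ-× (no _)  _       = refl

  χ*χ-cong : ∀ {c d} {C : Set c} {D : Set d} (a? : Dec A) (b? : Dec B) (c? : Dec C) (d? : Dec D) →
             (A × B → C × D) → (C × D → A × B) → χ a? * χ b? ≡ χ c? * χ d?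
  χ*χ-cong a? b? c? d? f g = begin
    χ a? * χ b?       ≡⟨ χ-× a? b? ⟨
    χ (a? ×-dec b?)   ≡⟨ χ-cong (a? ×-dec b?) (c? ×-dec d?) f g ⟩
    χ (c? ×-dec d?)   ≡⟨ χ-× c? d? ⟩
    χ c? * χ d?       ∎
    where open ≡-Reasoning

  χ-¬ : (a? : Dec A) → χ a? + χ (¬? a?) ≡ 1
  χ-¬ (yes _) = refl
  χ-¬ (no _)  = refl

  ∑-mono-≤ : {f g : Fin m → ℕ} → (∀ i → f i ≤ g i) → sum f ≤ sum g
  ∑-mono-≤ {zero}  _   = z≤n
  ∑-mono-≤ {suc m} f≤g = ℕ.+-mono-≤ (f≤g fzero) (∑-mono-≤ (f≤g ∘ fsuc))

  ∑-∣ : ∀ {d} (f : Fin m → ℕ) → (∀ i → d ∣ f i) → d ∣ sum f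
  ∑-∣ {zero}  {d} f d∣f = d ∣0
  ∑-∣ {suc m}     f d∣f = ∣m∣n⇒∣m+n (d∣f fzero) (∑-∣ (f ∘ fsuc) (d∣f ∘ fsuc))

  ∑-1 : ∑[ x < m ] 1 ≡ m
  ∑-1 {zero}  = refl
  ∑-1 {suc m} = cong suc ∑-1

  ∑-point : (a : Fin m) (g : Fin m → ℕ) → ∑[ x < m ] (χ (a ≟ x) * g x) ≡ g a
  ∑-point {suc m} fzero g = trans (cong₂ _+_ (ℕ.*-identityˡ (g fzero)) rest≡0) (ℕ.+-identityʳ (g fzero))
    where
    rest≡0 : ∑[ x < m ] (χ (fzero ≟ fsuc x) * g (fsuc x)) ≡ 0
    rest≡0 = trans (sum-cong-≗ (λ x → cong (_* g (fsuc x)) (χ-no (fzero ≟ fsuc x) λ ()))) (sum-replicate-zero m)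
  ∑-point {suc m} (fsuc a) g = begin
    χ (fsuc a ≟ fzero) * g fzero + ∑[ x < m ] (χ (fsuc a ≟ fsuc x) * g (fsuc x))
      ≡⟨ cong₂ _+_ (cong (_* g fzero) (χ-no (fsuc a ≟ fzero) λ ()))
                   (sum-cong-≗ (λ x → cong (_* g (fsuc x))
                                             (χ-cong (fsuc a ≟ fsuc x) (a ≟ x) suc-injective (cong fsuc)))) ⟩
    ∑[ x < m ] (χ (a ≟ x) * g (fsuc x))
      ≡⟨ ∑-point a (g ∘ fsuc) ⟩
    g (fsuc a) ∎
    where open ≡-Reasoning

  ∑-fibres : (φ : Fin m → Fin k) (g : Fin m → ℕ) →
             ∑[ x < m ] g x ≡ ∑[ y < k ] ∑[ x < m ] (χ (φ x ≟ y) * g x)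
  ∑-fibres {m} {k} φ g = begin
    ∑[ x < m ] g x                             ≡⟨ sum-cong-≗ (λ x → ∑-point (φ x) (λ _ → g x)) ⟨
    ∑[ x < m ] ∑[ y < k ] (χ (φ x ≟ y) * g x)  ≡⟨ ∑-comm (λ x y → χ (φ x ≟ y) * g x) ⟩
    ∑[ y < k ] ∑[ x < m ] (χ (φ x ≟ y) * g x)  ∎
    where open ≡-Reasoning

  count : {P : Pred (Fin m) ℓ} → Decidable P → ℕ
  count {m} P? = ∑[ x < m ] χ (P? x)

  count-cong : {P : Pred (Fin m) ℓ} {Q : Pred (Fin m) ℓ′} (P? : Decidable P) (Q? : Decidable Q) →
               (∀ {x} → P x → Q x) → (∀ {x} → Q x → P x) → count P? ≡ count Q?
  count-cong P? Q? P⇒Q Q⇒P = sum-cong-≗ (λ x → χ-cong (P? x) (Q? x) P⇒Q Q⇒P)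

  count-≡ : (a : Fin m) → count (a ≟_) ≡ 1
  count-≡ a = trans (sum-cong-≗ (λ x → ≡.sym (ℕ.*-identityʳ (χ (a ≟ x))))) (∑-point a (λ _ → 1))

  count-∅ : {P : Pred (Fin m) ℓ} (P? : Decidable P) → (∀ x → ¬ P x) → count P? ≡ 0
  count-∅ {m} P? ∄P = trans (sum-cong-≗ (λ x → χ-no (P? x) (∄P x))) (sum-replicate-zero m)

  count-split : {P : Pred (Fin m) ℓ} {Q : Pred (Fin m) ℓ′} (P? : Decidable P) (Q? : Decidable Q) →
                count P? ≡ count (λ x → P? x ×-dec Q? x) + count (λ x → P? x ×-dec ¬? (Q? x))
  count-split P? Q? =
    trans (sum-cong-≗ split) (∑-distrib-+ (λ x → χ (P? x ×-dec Q? x)) (λ x → χ (P? x ×-dec ¬? (Q? x))))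
    where
    split : ∀ x → χ (P? x) ≡ χ (P? x ×-dec Q? x) + χ (P? x ×-dec ¬? (Q? x))
    split x with P? x | Q? x
    ... | yes _ | yes _ = refl
    ... | yes _ | no _  = refl
    ... | no _  | _     = refl

  count+count∁ : {P : Pred (Fin m) ℓ} (P? : Decidable P) → count P? + count (¬? ∘ P?) ≡ m
  count+count∁ {m} P? = begin
    count P? + count (¬? ∘ P?)              ≡⟨ ∑-distrib-+ (χ ∘ P?) (χ ∘ ¬? ∘ P?) ⟨
    ∑[ x < m ] (χ (P? x) + χ (¬? (P? x)))   ≡⟨ sum-cong-≗ (χ-¬ ∘ P?) ⟩
    ∑[ x < m ] 1                            ≡⟨ ∑-1 ⟩
    m                                       ∎
    where open ≡-Reasoning

  1≤count : {P : Pred (Fin m) ℓ} (P? : Decidable P) {a : Fin m} → P a → 1 ≤ count P?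
  1≤count P? {a} Pa = ℕ.≤-trans (ℕ.≤-reflexive (sym (count-≡ a))) (∑-mono-≤ below)
    where
    below : ∀ x → χ (a ≟ x) ≤ χ (P? x)
    below x with a ≟ x
    ... | yes refl = ℕ.≤-reflexive (sym (χ-yes (P? x) Pa))
    ... | no _     = z≤n

  2≤count : {P : Pred (Fin m) ℓ} (P? : Decidable P) {a b : Fin m} → a ≢ b → P a → P b → 2 ≤ count P?
  2≤count {m} P? {a} {b} a≢b Pa Pb = begin
    2                                    ≡⟨ cong₂ _+_ (count-≡ a) (count-≡ b) ⟨
    count (a ≟_) + count (b ≟_)          ≡⟨ ∑-distrib-+ (λ x → χ (a ≟ x)) (λ x → χ (b ≟ x)) ⟨
    ∑[ x < m ] (χ (a ≟ x) + χ (b ≟ x))   ≤⟨ ∑-mono-≤ below ⟩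
    count P?                             ∎
    where
    open ℕ.≤-Reasoning
    below : ∀ x → χ (a ≟ x) + χ (b ≟ x) ≤ χ (P? x)
    below x with a ≟ x | b ≟ x
    ... | yes refl | yes refl = ⊥-elim (a≢b refl)
    ... | yes refl | no _     = ℕ.≤-reflexive (sym (χ-yes (P? x) Pa))
    ... | no _     | yes refl = ℕ.≤-reflexive (sym (χ-yes (P? x) Pb))
    ... | no _     | no _     = z≤n

  count<m : {P : Pred (Fin m) ℓ} (P? : Decidable P) {a : Fin m} → ¬ P a → count P? < m
  count<m {m} P? ¬Pa = begin-strict
    count P?                    <⟨ ℕ.m<m+n (count P?) (1≤count (¬? ∘ P?) ¬Pa) ⟩
    count P? + count (¬? ∘ P?)  ≡⟨ count+count∁ P? ⟩
    m                           ∎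
    where open ℕ.≤-Reasoning

  count-fibres : (φ : Fin m → Fin k) → m ≡ ∑[ y < k ] count (λ x → φ x ≟ y)
  count-fibres {m} {k} φ = begin
    m                                         ≡⟨ ∑-1 ⟨
    ∑[ x < m ] 1                              ≡⟨ ∑-fibres φ (λ _ → 1) ⟩
    ∑[ y < k ] ∑[ x < m ] (χ (φ x ≟ y) * 1)
      ≡⟨ sum-cong-≗ (λ y → sum-cong-≗ (λ x → ℕ.*-identityʳ (χ (φ x ≟ y)))) ⟩
    ∑[ y < k ] count (λ x → φ x ≟ y)          ∎
    where open ≡-Reasoning

  count-image : (f : Fin k → Fin m) → (∀ {i j} → f i ≡ f j → i ≡ j) →
                count (λ y → any? (λ i → f i ≟ y)) ≡ k
  count-image f f-injective = trans (sum-cong-≗ fibre) (sym (count-fibres f))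
    where
    fibre : ∀ y → χ (any? (λ i → f i ≟ y)) ≡ count (λ i → f i ≟ y)
    fibre y with any? (λ i → f i ≟ y)
    ... | yes (j , refl) =
      sym (trans (count-cong (λ i → f i ≟ f j) (j ≟_) (sym ∘ f-injective) (cong f ∘ sym)) (count-≡ j))
    ... | no ∄i          = sym (count-∅ (λ i → f i ≟ y) (λ i fi≡y → ∄i (i , fi≡y)))

-- Classes of a decidable partial equivalence relation on Fin

module _ where
  open ≡ using (refl; sym; trans; cong; subst; module ≡-Reasoning)

  least : {P : Pred (Fin m) ℓ} → Decidable P → ∀ {x} → P x → ∃ λ y → P y × (∀ {z} → P z → y ≤ᶠ z)
  least {suc m} P? Px with P? fzero
  least {suc m}         P? Px          | yes P0 = fzero , P0 , λ _ → z≤n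
  least {suc m}         P? {fzero} Px  | no ¬P0 = ⊥-elim (¬P0 Px)
  least {suc m} {P = P} P? {fsuc x} Px | no ¬P0 with least (P? ∘ fsuc) Px
  ... | y , Py , y-least = fsuc y , Py , fsuc-y-least
    where
    fsuc-y-least : ∀ {z} → P z → fsuc y ≤ᶠ z
    fsuc-y-least {fzero}  Pz = ⊥-elim (¬P0 Pz)
    fsuc-y-least {fsuc z} Pz = s≤s (y-least Pz)

  least-unique : {P : Pred (Fin m) ℓ} {Q : Pred (Fin m) ℓ′} {y y′ : Fin m} →
                 (∀ {z} → P z → Q z) → (∀ {z} → Q z → P z) →
                 P y → (∀ {z} → P z → y ≤ᶠ z) → Q y′ → (∀ {z} → Q z → y′ ≤ᶠ z) → y ≡ y′
  least-unique P⇒Q Q⇒P Py y-least Qy′ y′-least = ≤-antisym (y-least (Q⇒P Qy′)) (y′-least (P⇒Q Py))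

  module Classes {R : Rel (Fin m) ℓ} (R? : Decidable₂ R) (R-sym : Symmetric R) (R-trans : Transitive R) where

    -- The disjunct y ≡ x makes the search succeed also for x outside the domain of R,
    -- where rep x is then junk.
    private
      leastBelow : ∀ x → ∃ λ y → (R y x ⊎ y ≡ x) × (∀ {z} → R z x ⊎ z ≡ x → y ≤ᶠ z)
      leastBelow x = least (λ y → R? y x ⊎-dec y ≟ x) (inj₂ refl)

    rep : Fin m → Fin m
    rep x = proj₁ (leastBelow x)

    rep-R : ∀ {x} → R x x → R (rep x) x
    rep-R {x} Rxx with proj₁ (proj₂ (leastBelow x))
    ... | inj₁ R-rep = R-rep
    ... | inj₂ rep≡x = subst (λ y → R y x) (sym rep≡x) Rxx

    rep-cong : ∀ {x x′} → R x x′ → rep x ≡ rep x′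
    rep-cong {x} {x′} Rxx′ with leastBelow x | leastBelow x′
    ... | y , Py , y-least | y′ , Qy′ , y′-least = least-unique to from Py y-least Qy′ y′-least
      where
      to : ∀ {z} → R z x ⊎ z ≡ x → R z x′ ⊎ z ≡ x′
      to (inj₁ Rzx)  = inj₁ (R-trans Rzx Rxx′)
      to (inj₂ refl) = inj₁ Rxx′
      from : ∀ {z} → R z x′ ⊎ z ≡ x′ → R z x ⊎ z ≡ x
      from (inj₁ Rzx′) = inj₁ (R-trans Rzx′ (R-sym Rxx′))
      from (inj₂ refl) = inj₁ (R-sym Rxx′)

    IsRep : Pred (Fin m) ℓ
    IsRep x = R x x × rep x ≡ x

    IsRep? : Decidable IsRep
    IsRep? x = R? x x ×-dec rep x ≟ x

    rep-IsRep : ∀ {x} → R x x → IsRep (rep x)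
    rep-IsRep Rxx = R-trans (rep-R Rxx) (R-sym (rep-R Rxx)) , rep-cong (rep-R Rxx)

    ∑-by-classes : (g : Fin m → ℕ) →
      ∑[ x < m ] (χ (R? x x) * g x) ≡ ∑[ r < m ] (χ (IsRep? r) * ∑[ x < m ] (χ (R? x r) * g x))
    ∑-by-classes g = begin
      ∑[ x < m ] (χ (R? x x) * g x)
        ≡⟨ ∑-fibres rep _ ⟩
      ∑[ r < m ] ∑[ x < m ] (χ (rep x ≟ r) * (χ (R? x x) * g x))
        ≡⟨ sum-cong-≗ (λ r → sum-cong-≗ (regroup r)) ⟩
      ∑[ r < m ] ∑[ x < m ] (χ (IsRep? r) * (χ (R? x r) * g x))
        ≡⟨ sum-cong-≗ (λ r → *-distribˡ-sum (χ (IsRep? r)) (λ x → χ (R? x r) * g x)) ⟨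
      ∑[ r < m ] (χ (IsRep? r) * ∑[ x < m ] (χ (R? x r) * g x)) ∎
      where
      open ≡-Reasoning
      classOf : ∀ {r x} → rep x ≡ r × R x x → IsRep r × R x r
      classOf (refl , Rxx) = rep-IsRep Rxx , R-sym (rep-R Rxx)
      repOf : ∀ {r x} → IsRep r × R x r → rep x ≡ r × R x x
      repOf ((_ , rep-r≡r) , Rxr) = trans (rep-cong Rxr) rep-r≡r , R-trans Rxr (R-sym Rxr)
      regroup : ∀ r x → χ (rep x ≟ r) * (χ (R? x x) * g x) ≡ χ (IsRep? r) * (χ (R? x r) * g x)
      regroup r x = begin
        χ (rep x ≟ r) * (χ (R? x x) * g x)   ≡⟨ ℕ.*-assoc (χ (rep x ≟ r)) _ _ ⟨
        χ (rep x ≟ r) * χ (R? x x) * g x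
          ≡⟨ cong (_* g x) (χ*χ-cong (rep x ≟ r) (R? x x) (IsRep? r) (R? x r) classOf repOf) ⟩
        χ (IsRep? r) * χ (R? x r) * g x      ≡⟨ ℕ.*-assoc (χ (IsRep? r)) _ _ ⟩
        χ (IsRep? r) * (χ (R? x r) * g x)    ∎

-- Central elements, commutators and powers in a group

IsCentral : (G : Group a ℓ) → Group.Carrier G → Set (a ⊔ ℓ)
IsCentral G x = ∀ y → x ∙ y ≈ y ∙ x
  where open Group G

module GroupTheory (G : Group a ℓ) where
  open Group G
  open GroupProperties G
  open MonoidMultProperties monoid using (×-congʳ; ×-homo-+; ×-assocˡ)
  open SetoidReasoning setoid

  ⁅_,_⁆ : Carrier → Carrier → Carrier
  ⁅ x , y ⁆ = ((x ⁻¹ ∙ y ⁻¹) ∙ x) ∙ y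

  conj : Carrier → Carrier → Carrier
  conj g x = (g ∙ x) ∙ g ⁻¹

  infixr 8 _^ᵍ_
  _^ᵍ_ : Carrier → ℕ → Carrier
  x ^ᵍ k = k ×ᵐ x
    where open RawMonoidDefinitions rawMonoid renaming (_×_ to _×ᵐ_)

  ⁅⁆-cong : ∀ {x x′ y y′} → x ≈ x′ → y ≈ y′ → ⁅ x , y ⁆ ≈ ⁅ x′ , y′ ⁆
  ⁅⁆-cong x≈x′ y≈y′ = ∙-cong (∙-cong (∙-cong (⁻¹-cong x≈x′) (⁻¹-cong y≈y′)) x≈x′) y≈y′

  abelian⇒⁅⁆≈ε : IsAbelian G → ∀ x y → ⁅ x , y ⁆ ≈ ε
  abelian⇒⁅⁆≈ε G-abelian x y = begin
    ((x ⁻¹ ∙ y ⁻¹) ∙ x) ∙ y   ≈⟨ ∙-congʳ (∙-congʳ (G-abelian (x ⁻¹) (y ⁻¹))) ⟩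
    ((y ⁻¹ ∙ x ⁻¹) ∙ x) ∙ y   ≈⟨ ∙-congʳ (assoc (y ⁻¹) (x ⁻¹) x) ⟩
    (y ⁻¹ ∙ (x ⁻¹ ∙ x)) ∙ y   ≈⟨ ∙-congʳ (∙-congˡ (inverseˡ x)) ⟩
    (y ⁻¹ ∙ ε) ∙ y            ≈⟨ ∙-congʳ (identityʳ (y ⁻¹)) ⟩
    y ⁻¹ ∙ y                  ≈⟨ inverseˡ y ⟩
    ε                         ∎

  ⁅⁆≈ε⇒commute : ∀ {x y} → ⁅ x , y ⁆ ≈ ε → x ∙ y ≈ y ∙ x
  ⁅⁆≈ε⇒commute {x} {y} ⁅x,y⁆≈ε = ⁻¹-injective (begin
    (x ∙ y) ⁻¹    ≈⟨ inverseˡ-unique (x ⁻¹ ∙ y ⁻¹) (x ∙ y) (trans (sym (assoc _ x y)) ⁅x,y⁆≈ε) ⟨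
    x ⁻¹ ∙ y ⁻¹   ≈⟨ ⁻¹-anti-homo-∙ y x ⟨
    (y ∙ x) ⁻¹    ∎)

  conj-∙ : ∀ g x y → conj g (x ∙ y) ≈ conj g x ∙ conj g y
  conj-∙ g x y = begin
    (g ∙ (x ∙ y)) ∙ g ⁻¹                  ≈⟨ ∙-congʳ (assoc g x y) ⟨
    ((g ∙ x) ∙ y) ∙ g ⁻¹                  ≈⟨ ∙-congʳ (∙-congʳ (identityʳ (g ∙ x))) ⟨
    (((g ∙ x) ∙ ε) ∙ y) ∙ g ⁻¹            ≈⟨ ∙-congʳ (∙-congʳ (∙-congˡ (inverseˡ g))) ⟨
    (((g ∙ x) ∙ (g ⁻¹ ∙ g)) ∙ y) ∙ g ⁻¹   ≈⟨ ∙-congʳ (∙-congʳ (assoc (g ∙ x) (g ⁻¹) g)) ⟨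
    ((conj g x ∙ g) ∙ y) ∙ g ⁻¹           ≈⟨ ∙-congʳ (assoc (conj g x) g y) ⟩
    (conj g x ∙ (g ∙ y)) ∙ g ⁻¹           ≈⟨ assoc (conj g x) (g ∙ y) (g ⁻¹) ⟩
    conj g x ∙ conj g y                   ∎

  conj-⁻¹ : ∀ g x → conj g (x ⁻¹) ≈ conj g x ⁻¹
  conj-⁻¹ g x = inverseʳ-unique (conj g x) (conj g (x ⁻¹)) (begin
    conj g x ∙ conj g (x ⁻¹)   ≈⟨ conj-∙ g x (x ⁻¹) ⟨
    conj g (x ∙ x ⁻¹)          ≈⟨ ∙-congʳ (∙-congˡ (inverseʳ x)) ⟩
    (g ∙ ε) ∙ g ⁻¹             ≈⟨ ∙-congʳ (identityʳ g) ⟩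
    g ∙ g ⁻¹                   ≈⟨ inverseʳ g ⟩
    ε                          ∎)

  conj-ε : ∀ x → conj ε x ≈ x
  conj-ε x = trans (∙-cong (identityˡ x) ε⁻¹≈ε) (identityʳ x)

  conj-comp : ∀ g h x → conj (g ∙ h) x ≈ conj g (conj h x)
  conj-comp g h x = begin
    ((g ∙ h) ∙ x) ∙ (g ∙ h) ⁻¹      ≈⟨ ∙-cong (assoc g h x) (⁻¹-anti-homo-∙ g h) ⟩
    (g ∙ (h ∙ x)) ∙ (h ⁻¹ ∙ g ⁻¹)   ≈⟨ assoc g (h ∙ x) (h ⁻¹ ∙ g ⁻¹) ⟩
    g ∙ ((h ∙ x) ∙ (h ⁻¹ ∙ g ⁻¹))   ≈⟨ ∙-congˡ (assoc (h ∙ x) (h ⁻¹) (g ⁻¹)) ⟨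
    g ∙ (conj h x ∙ g ⁻¹)           ≈⟨ assoc g (conj h x) (g ⁻¹) ⟨
    conj g (conj h x)               ∎

  ε-central : IsCentral G ε
  ε-central y = trans (identityˡ y) (sym (identityʳ y))

  central-resp : ∀ {x y} → x ≈ y → IsCentral G x → IsCentral G y
  central-resp {x} {y} x≈y x-central z = begin
    y ∙ z   ≈⟨ ∙-congʳ x≈y ⟨
    x ∙ z   ≈⟨ x-central z ⟩
    z ∙ x   ≈⟨ ∙-congˡ x≈y ⟩
    z ∙ y   ∎

  ∙-central : ∀ {x y} → IsCentral G x → IsCentral G y → IsCentral G (x ∙ y)
  ∙-central {x} {y} x-central y-central z = begin
    (x ∙ y) ∙ z   ≈⟨ assoc x y z ⟩
    x ∙ (y ∙ z)   ≈⟨ ∙-congˡ (y-central z) ⟩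
    x ∙ (z ∙ y)   ≈⟨ assoc x z y ⟨
    (x ∙ z) ∙ y   ≈⟨ ∙-congʳ (x-central z) ⟩
    (z ∙ x) ∙ y   ≈⟨ assoc z x y ⟩
    z ∙ (x ∙ y)   ∎

  ⁻¹-central : ∀ {x} → IsCentral G x → IsCentral G (x ⁻¹)
  ⁻¹-central {x} x-central y = begin
    x ⁻¹ ∙ y         ≈⟨ ∙-congˡ (⁻¹-involutive y) ⟨
    x ⁻¹ ∙ y ⁻¹ ⁻¹   ≈⟨ ⁻¹-anti-homo-∙ (y ⁻¹) x ⟨
    (y ⁻¹ ∙ x) ⁻¹    ≈⟨ ⁻¹-cong (x-central (y ⁻¹)) ⟨
    (x ∙ y ⁻¹) ⁻¹    ≈⟨ ⁻¹-anti-homo-∙ x (y ⁻¹) ⟩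
    y ⁻¹ ⁻¹ ∙ x ⁻¹   ≈⟨ ∙-congʳ (⁻¹-involutive y) ⟩
    y ∙ x ⁻¹         ∎

  central-conj : ∀ {x} → IsCentral G x → ∀ g → conj g x ≈ x
  central-conj {x} x-central g = begin
    (g ∙ x) ∙ g ⁻¹   ≈⟨ ∙-congʳ (x-central g) ⟨
    (x ∙ g) ∙ g ⁻¹   ≈⟨ assoc x g (g ⁻¹) ⟩
    x ∙ (g ∙ g ⁻¹)   ≈⟨ ∙-congˡ (inverseʳ g) ⟩
    x ∙ ε            ≈⟨ identityʳ x ⟩
    x                ∎

  centre-normal : IsNormalSubgroup G (IsCentral G)
  centre-normal = record
    { isSubgroup = record
      { resp = central-resp
      ; ε∈   = ε-central
      ; ∙∈   = ∙-central
      ; ⁻¹∈  = ⁻¹-central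
      }
    ; conj∈ = λ g x-central → central-resp (sym (central-conj x-central g)) x-central
    }

  ^-cong : ∀ {x y} k → x ≈ y → x ^ᵍ k ≈ y ^ᵍ k
  ^-cong k = ×-congʳ k

  ε^ : ∀ k → ε ^ᵍ k ≈ ε
  ε^ zero    = refl
  ε^ (suc k) = trans (identityˡ _) (ε^ k)

  ^-central : ∀ {x} → IsCentral G x → ∀ k → IsCentral G (x ^ᵍ k)
  ^-central x-central zero    = ε-central
  ^-central x-central (suc k) = ∙-central x-central (^-central x-central k)

  ^-* : ∀ {w} N → w ^ᵍ N ≈ ε → ∀ k → w ^ᵍ (k * N) ≈ ε
  ^-* {w} N w^N≈ε k = begin
    w ^ᵍ (k * N)    ≈⟨ ×-assocˡ w k N ⟨
    (w ^ᵍ N) ^ᵍ k   ≈⟨ ^-cong k w^N≈ε ⟩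
    ε ^ᵍ k          ≈⟨ ε^ k ⟩
    ε               ∎

  ^-mod : ∀ {w} N .{{_ : NonZero N}} → w ^ᵍ N ≈ ε → ∀ k → w ^ᵍ k ≈ w ^ᵍ (k % N)
  ^-mod {w} N w^N≈ε k = begin
    w ^ᵍ k                              ≡⟨ ≡.cong (w ^ᵍ_) (m≡m%n+[m/n]*n k N) ⟩
    w ^ᵍ (k % N + (k / N) * N)          ≈⟨ ×-homo-+ w (k % N) ((k / N) * N) ⟩
    w ^ᵍ (k % N) ∙ w ^ᵍ ((k / N) * N)   ≈⟨ ∙-congˡ (^-* N w^N≈ε (k / N)) ⟩
    w ^ᵍ (k % N) ∙ ε                    ≈⟨ identityʳ _ ⟩
    w ^ᵍ (k % N)                        ∎

  ^-⁻¹ : ∀ {w} N .{{_ : NonZero N}} → w ^ᵍ N ≈ ε → ∀ k → (w ^ᵍ k) ⁻¹ ≈ w ^ᵍ (k * pred N)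
  ^-⁻¹ {w} N w^N≈ε k = sym (inverseʳ-unique (w ^ᵍ k) (w ^ᵍ (k * pred N)) (begin
    w ^ᵍ k ∙ w ^ᵍ (k * pred N)   ≈⟨ ×-homo-+ w k (k * pred N) ⟨
    w ^ᵍ (k + k * pred N)        ≡⟨ ≡.cong (w ^ᵍ_) (ℕ.*-suc k (pred N)) ⟨
    w ^ᵍ (k * suc (pred N))      ≡⟨ ≡.cong (λ n → w ^ᵍ (k * n)) (ℕ.suc-pred N) ⟩
    w ^ᵍ (k * N)                 ≈⟨ ^-* N w^N≈ε k ⟩
    ε                            ∎))

  ^-cancel : ∀ {w} i j → i ≤ j → w ^ᵍ i ≈ w ^ᵍ j → w ^ᵍ (j ∸ i) ≈ ε
  ^-cancel {w} i j i≤j w^i≈w^j = identityʳ-unique (w ^ᵍ i) (w ^ᵍ (j ∸ i)) (begin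
    w ^ᵍ i ∙ w ^ᵍ (j ∸ i)   ≈⟨ ×-homo-+ w i (j ∸ i) ⟨
    w ^ᵍ (i + (j ∸ i))      ≡⟨ ≡.cong (w ^ᵍ_) (ℕ.m+[n∸m]≡n i≤j) ⟩
    w ^ᵍ j                  ≈⟨ w^i≈w^j ⟨
    w ^ᵍ i                  ∎)

  ⟨_⟩ : Carrier → Pred Carrier (a ⊔ ℓ)
  ⟨ w ⟩ x = Lift a (∃ λ k → x ≈ w ^ᵍ k)

  ⟨⟩-normal : ∀ {w} → IsCentral G w → ∀ N .{{_ : NonZero N}} → w ^ᵍ N ≈ ε → IsNormalSubgroup G ⟨ w ⟩
  ⟨⟩-normal {w} w-central N w^N≈ε = record
    { isSubgroup = record
      { resp = λ { x≈y (lift (k , x≈w^k)) → lift (k , trans (sym x≈y) x≈w^k) }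
      ; ε∈   = lift (0 , refl)
      ; ∙∈   = λ { (lift (k , x≈w^k)) (lift (j , y≈w^j)) →
                   lift (k + j , trans (∙-cong x≈w^k y≈w^j) (sym (×-homo-+ w k j))) }
      ; ⁻¹∈  = λ { (lift (k , x≈w^k)) → lift (k * pred N , trans (⁻¹-cong x≈w^k) (^-⁻¹ N w^N≈ε k)) }
      }
    ; conj∈ = λ { g (lift (k , x≈w^k)) →
                  lift (k , trans (central-conj (central-resp (sym x≈w^k) (^-central w-central k)) g) x≈w^k) }
    }

-- Group homomorphisms

module Homomorphism {G : Group a ℓ} {K : Group b ℓ′} {φ : Group.Carrier G → Group.Carrier K}
  (φ-homo : GroupMorphisms.IsGroupHomomorphism (Group.rawGroup G) (Group.rawGroup K) φ) where
  private
    module G = Group G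
    module K = Group K
    module G′ = GroupTheory G
    module K′ = GroupTheory K
  open GroupMorphisms.IsGroupHomomorphism φ-homo public renaming (homo to ∙-homo)
  open SetoidReasoning K.setoid

  homo-^ : ∀ x k → φ (x G′.^ᵍ k) K.≈ φ x K′.^ᵍ k
  homo-^ x zero    = ε-homo
  homo-^ x (suc k) = K.trans (∙-homo x (x G′.^ᵍ k)) (K.∙-congˡ (homo-^ x k))

  homo-^-≈ : ∀ {x y} k → φ x K.≈ y → φ (x G′.^ᵍ k) K.≈ y K′.^ᵍ k
  homo-^-≈ {x} k φx≈y = K.trans (homo-^ x k) (K′.^-cong k φx≈y)

  homo-⁅⁆ : ∀ x y → φ G′.⁅ x , y ⁆ K.≈ K′.⁅ φ x , φ y ⁆
  homo-⁅⁆ x y = begin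
    φ (((x G.⁻¹ G.∙ y G.⁻¹) G.∙ x) G.∙ y)           ≈⟨ ∙-homo _ y ⟩
    φ ((x G.⁻¹ G.∙ y G.⁻¹) G.∙ x) K.∙ φ y           ≈⟨ K.∙-congʳ (∙-homo _ x) ⟩
    (φ (x G.⁻¹ G.∙ y G.⁻¹) K.∙ φ x) K.∙ φ y         ≈⟨ K.∙-congʳ (K.∙-congʳ (∙-homo _ _)) ⟩
    ((φ (x G.⁻¹) K.∙ φ (y G.⁻¹)) K.∙ φ x) K.∙ φ y
      ≈⟨ K.∙-congʳ (K.∙-congʳ (K.∙-cong (⁻¹-homo x) (⁻¹-homo y))) ⟩
    ((φ x K.⁻¹ K.∙ φ y K.⁻¹) K.∙ φ x) K.∙ φ y       ∎

  homo-swap : ∀ {x y} → φ x K.∙ φ y K.≈ φ y K.∙ φ x → φ (x G.∙ y) K.≈ φ (y G.∙ x)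
  homo-swap {x} {y} φx∙φy≈φy∙φx = begin
    φ (x G.∙ y)   ≈⟨ ∙-homo x y ⟩
    φ x K.∙ φ y   ≈⟨ φx∙φy≈φy∙φx ⟩
    φ y K.∙ φ x   ≈⟨ ∙-homo y x ⟨
    φ (y G.∙ x)   ∎

  commute-image : ∀ {x y} → x G.∙ y G.≈ y G.∙ x → φ x K.∙ φ y K.≈ φ y K.∙ φ x
  commute-image {x} {y} x∙y≈y∙x = begin
    φ x K.∙ φ y   ≈⟨ ∙-homo x y ⟨
    φ (x G.∙ y)   ≈⟨ ⟦⟧-cong x∙y≈y∙x ⟩
    φ (y G.∙ x)   ≈⟨ ∙-homo y x ⟩
    φ y K.∙ φ x   ∎

  central-image : Surjective G._≈_ K._≈_ φ → ∀ {x} → IsCentral G x → IsCentral K (φ x)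
  central-image φ-surjective {x} x-central y with φ-surjective y
  ... | x′ , φx′≈y = begin
    φ x K.∙ y      ≈⟨ K.∙-congˡ (φx′≈y G.refl) ⟨
    φ x K.∙ φ x′   ≈⟨ commute-image (x-central x′) ⟩
    φ x′ K.∙ φ x   ≈⟨ K.∙-congʳ (φx′≈y G.refl) ⟩
    y K.∙ φ x      ∎

  abelian-image : Surjective G._≈_ K._≈_ φ → IsAbelian G → IsAbelian K
  abelian-image φ-surjective G-abelian y y′ with φ-surjective y
  ... | x , φx≈y = K.trans (K.∙-congʳ (K.sym (φx≈y G.refl)))
                     (K.trans (central-image φ-surjective (G-abelian x) y′) (K.∙-congˡ (φx≈y G.refl)))

  Der⊆kernel : IsAbelian K → ∀ {x} → Der G x → φ x K.≈ K.ε
  Der⊆kernel K-abelian (comm x y) = K.trans (homo-⁅⁆ x y) (K′.abelian⇒⁅⁆≈ε K-abelian (φ x) (φ y))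
  Der⊆kernel K-abelian one = ε-homo
  Der⊆kernel K-abelian (mul {x} {y} Dx Dy) = begin
    φ (x G.∙ y)   ≈⟨ ∙-homo x y ⟩
    φ x K.∙ φ y   ≈⟨ K.∙-cong (Der⊆kernel K-abelian Dx) (Der⊆kernel K-abelian Dy) ⟩
    K.ε K.∙ K.ε   ≈⟨ K.identityˡ K.ε ⟩
    K.ε           ∎
  Der⊆kernel K-abelian (inv {x} Dx) = begin
    φ (x G.⁻¹)    ≈⟨ ⁻¹-homo x ⟩
    φ x K.⁻¹      ≈⟨ K.⁻¹-cong (Der⊆kernel K-abelian Dx) ⟩
    K.ε K.⁻¹      ≈⟨ GroupProperties.ε⁻¹≈ε K ⟩
    K.ε           ∎
  Der⊆kernel K-abelian (resp x≈y Dx) = K.trans (⟦⟧-cong (G.sym x≈y)) (Der⊆kernel K-abelian Dx)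

module DirectProductProjections
  {G : Group a ℓ} {b₁ ℓ₁ b₂ ℓ₂ : Level} {K₁ : Group b₁ ℓ₁} {K₂ : Group b₂ ℓ₂}
  {f : Group.Carrier G → Group.Carrier (K₁ ×ᴳ K₂)}
  (f-homo : GroupMorphisms.IsGroupHomomorphism (Group.rawGroup G) (Group.rawGroup (K₁ ×ᴳ K₂)) f) where
  open GroupMorphisms.IsGroupHomomorphism f-homo

  proj₁-homo : GroupMorphisms.IsGroupHomomorphism (Group.rawGroup G) (Group.rawGroup K₁) (proj₁ ∘ f)
  proj₁-homo = record
    { isMonoidHomomorphism = record
      { isMagmaHomomorphism = record
        { isRelHomomorphism = record { cong = proj₁ ∘ ⟦⟧-cong }
        ; homo              = λ x y → proj₁ (homo x y)
        }
      ; ε-homo = proj₁ ε-homo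
      }
    ; ⁻¹-homo = λ x → proj₁ (⁻¹-homo x)
    }

  proj₂-homo : GroupMorphisms.IsGroupHomomorphism (Group.rawGroup G) (Group.rawGroup K₂) (proj₂ ∘ f)
  proj₂-homo = record
    { isMonoidHomomorphism = record
      { isMagmaHomomorphism = record
        { isRelHomomorphism = record { cong = proj₂ ∘ ⟦⟧-cong }
        ; homo              = λ x y → proj₂ (homo x y)
        }
      ; ε-homo = proj₂ ε-homo
      }
    ; ⁻¹-homo = λ x → proj₂ (⁻¹-homo x)
    }

-- Finite groups: cosets, actions, orders of elements

-- A finite group is modelled on Fin n with propositional equality, so that membership in
-- subsets is decidable and subsets can be counted.
record FinGroup (n : ℕ) : Set where
  infixl 7 _∙_
  infix  8 _⁻¹
  field
    _∙_     : Op₂ (Fin n)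
    ε       : Fin n
    _⁻¹     : Op₁ (Fin n)
    isGroup : IsGroup _≡_ _∙_ ε _⁻¹

  group : Group 0ℓ 0ℓ
  group = record { isGroup = isGroup }

module FiniteGroup {n : ℕ} (G : FinGroup n) where
  open FinGroup G public
  open GroupTheory group public using (⁅_,_⁆; conj; _^ᵍ_)

  open ≡ using (refl; sym; trans; cong; subst; module ≡-Reasoning)
  open IsGroup isGroup using (assoc; inverseˡ)
  open GroupProperties group using (⁻¹-involutive; ⁻¹-anti-homo-∙; \\-leftDividesˡ; \\-leftDividesʳ)
  open GroupTheory group using (conj-∙; conj-⁻¹; conj-ε; conj-comp; ^-mod; ^-*; ^-⁻¹; ^-cancel)

  ∑-translate : ∀ a (g : Fin n → ℕ) → ∑[ x < n ] g (a ∙ x) ≡ ∑[ x < n ] g x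
  ∑-translate a g = sym (∑-permute g (permutation (a ∙_) (a ⁻¹ ∙_) (\\-leftDividesˡ a) (\\-leftDividesʳ a)))

  IsCentral? : Decidable (IsCentral group)
  IsCentral? x = all? (λ y → x ∙ y ≟ y ∙ x)

  module Cosets {ℓ} {S : Pred (Fin n) ℓ} (S? : Decidable S) (S-subgroup : IsSubgroup group S) where
    open IsSubgroup S-subgroup

    _∼_ : Fin n → Fin n → Set ℓ
    x ∼ y = S (y ⁻¹ ∙ x)

    _∼?_ : ∀ x y → Dec (x ∼ y)
    x ∼? y = S? (y ⁻¹ ∙ x)

    ∼-refl : ∀ {x} → x ∼ x
    ∼-refl {x} = subst S (sym (inverseˡ x)) ε∈

    ∼-sym : ∀ {x y} → x ∼ y → y ∼ x
    ∼-sym {x} {y} y⁻¹x∈S = subst S eq (⁻¹∈ y⁻¹x∈S)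
      where
      eq : (y ⁻¹ ∙ x) ⁻¹ ≡ x ⁻¹ ∙ y
      eq = trans (⁻¹-anti-homo-∙ (y ⁻¹) x) (cong (x ⁻¹ ∙_) (⁻¹-involutive y))

    ∼-trans : ∀ {x y z} → x ∼ y → y ∼ z → x ∼ z
    ∼-trans {x} {y} {z} y⁻¹x∈S z⁻¹y∈S = subst S eq (∙∈ z⁻¹y∈S y⁻¹x∈S)
      where
      eq : (z ⁻¹ ∙ y) ∙ (y ⁻¹ ∙ x) ≡ z ⁻¹ ∙ x
      eq = trans (assoc _ _ _) (cong (z ⁻¹ ∙_) (\\-leftDividesˡ y x))

    open Classes _∼?_ ∼-sym ∼-trans public

    index : ℕ
    index = count IsRep?

    coset-size : ∀ r → count (_∼? r) ≡ count S?
    coset-size r = begin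
      ∑[ x < n ] χ (S? (r ⁻¹ ∙ x))         ≡⟨ ∑-translate r (λ x → χ (S? (r ⁻¹ ∙ x))) ⟨
      ∑[ x < n ] χ (S? (r ⁻¹ ∙ (r ∙ x)))   ≡⟨ sum-cong-≗ (λ x → cong (χ ∘ S?) (\\-leftDividesʳ r x)) ⟩
      ∑[ x < n ] χ (S? x)                  ∎
      where open ≡-Reasoning

    lagrange : n ≡ index * count S?
    lagrange = begin
      n                                     ≡⟨ ∑-1 ⟨
      ∑[ x < n ] 1                          ≡⟨ sum-cong-≗ (λ x → cong (_* 1) (χ-yes (x ∼? x) ∼-refl)) ⟨
      ∑[ x < n ] (χ (x ∼? x) * 1)           ≡⟨ ∑-by-classes (λ _ → 1) ⟩
      ∑[ r < n ] (χ (IsRep? r) * ∑[ x < n ] (χ (x ∼? r) * 1))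
        ≡⟨ sum-cong-≗ (λ r → cong (χ (IsRep? r) *_)
                                  (trans (sum-cong-≗ (λ x → ℕ.*-identityʳ (χ (x ∼? r)))) (coset-size r))) ⟩
      ∑[ r < n ] (χ (IsRep? r) * count S?)  ≡⟨ *-distribʳ-sum (count S?) (χ ∘ IsRep?) ⟨
      index * count S?                      ∎
      where open ≡-Reasoning

    index∣n : index ∣ n
    index∣n = divides (count S?) (trans lagrange (ℕ.*-comm index (count S?)))

  module Action {m ℓ} {X : Pred (Fin m) ℓ} (X? : Decidable X) (act : Fin n → Fin m → Fin m)
                (act-X : ∀ g {x} → X x → X (act g x))
                (act-ε : ∀ {x} → X x → act ε x ≡ x)
                (act-∙ : ∀ g h {x} → X x → act (g ∙ h) x ≡ act g (act h x)) where

    act-inverse : ∀ g {x} → X x → act (g ⁻¹) (act g x) ≡ x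
    act-inverse g {x} Xx = trans (sym (act-∙ (g ⁻¹) g Xx)) (trans (cong (λ h → act h x) (inverseˡ g)) (act-ε Xx))

    act-injective : ∀ g {x y} → X x → X y → act g x ≡ act g y → x ≡ y
    act-injective g Xx Xy gx≡gy = trans (sym (act-inverse g Xx)) (trans (cong (act (g ⁻¹)) gx≡gy) (act-inverse g Xy))

    Orbit : Fin m → Fin m → Set ℓ
    Orbit x y = X x × ∃ λ g → act g x ≡ y

    Orbit? : ∀ x y → Dec (Orbit x y)
    Orbit? x y = X? x ×-dec any? (λ g → act g x ≟ y)

    orbit-sym : ∀ {x y} → Orbit x y → Orbit y x
    orbit-sym (Xx , g , refl) = act-X g Xx , g ⁻¹ , act-inverse g Xx

    orbit-trans : ∀ {x y z} → Orbit x y → Orbit y z → Orbit x z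
    orbit-trans (Xx , g , refl) (_ , h , refl) = Xx , h ∙ g , act-∙ h g Xx

    module Orbits = Classes Orbit? orbit-sym orbit-trans

    orbitSize stabiliserSize : Fin m → ℕ
    orbitSize x      = count (Orbit? x)
    stabiliserSize x = count (λ g → act g x ≟ x)

    orbit-stabiliser : ∀ {x} → X x → n ≡ orbitSize x * stabiliserSize x
    orbit-stabiliser {x} Xx = begin
      n                                                ≡⟨ count-fibres (λ g → act g x) ⟩
      ∑[ y < m ] count (λ g → act g x ≟ y)             ≡⟨ sum-cong-≗ fibre ⟩
      ∑[ y < m ] (χ (Orbit? x y) * stabiliserSize x)   ≡⟨ *-distribʳ-sum (stabiliserSize x) (χ ∘ Orbit? x) ⟨
      orbitSize x * stabiliserSize x                   ∎
      where
      open ≡-Reasoning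
      fibre : ∀ y → count (λ g → act g x ≟ y) ≡ χ (Orbit? x y) * stabiliserSize x
      fibre y with Orbit? x y
      ... | no ¬orbit          = count-∅ (λ g → act g x ≟ y) (λ g gx≡y → ¬orbit (Xx , g , gx≡y))
      ... | yes (_ , h , refl) = begin
        ∑[ g < n ] χ (act g x ≟ act h x)         ≡⟨ ∑-translate h (λ g → χ (act g x ≟ act h x)) ⟨
        ∑[ g < n ] χ (act (h ∙ g) x ≟ act h x)
          ≡⟨ count-cong (λ g → act (h ∙ g) x ≟ act h x) (λ g → act g x ≟ x)
               (λ {g} hgx≡hx → act-injective h (act-X g Xx) Xx (trans (sym (act-∙ h g Xx)) hgx≡hx))
               (λ {g} gx≡x → trans (act-∙ h g Xx) (cong (act h) gx≡x)) ⟩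
        stabiliserSize x                         ≡⟨ ℕ.*-identityˡ _ ⟨
        1 * stabiliserSize x                     ∎

    orbitSize∣n : ∀ {x} → X x → orbitSize x ∣ n
    orbitSize∣n {x} Xx = divides (stabiliserSize x) (trans (orbit-stabiliser Xx) (ℕ.*-comm (orbitSize x) _))

    Fixed : Pred (Fin m) 0ℓ
    Fixed x = ∀ g → act g x ≡ x

    Fixed? : Decidable Fixed
    Fixed? x = all? (λ g → act g x ≟ x)

    orbit-fixed : ∀ {x y} → Orbit x y → Fixed x → x ≡ y
    orbit-fixed (_ , g , refl) x-fixed = sym (x-fixed g)

    -- The non-fixed points split into orbits, each of size dividing n and at least 2.
    fixed-points : ∀ {p} → (∀ {d} → d ∣ n → d ≡ 1 ⊎ p ∣ d) →
                   p ∣ count (λ x → X? x ×-dec ¬? (Fixed? x))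
    fixed-points {p} p∣divisors = subst (p ∣_) (sym by-orbits) (∑-∣ _ p∣orbit)
      where
      open Orbits using (IsRep?; ∑-by-classes)
      open ≡-Reasoning
      nonFixed-orbit : ∀ r → ∑[ x < m ] (χ (Orbit? x r) * χ (¬? (Fixed? x))) ≡ χ (¬? (Fixed? r)) * orbitSize r
      nonFixed-orbit r = begin
        ∑[ x < m ] (χ (Orbit? x r) * χ (¬? (Fixed? x)))
          ≡⟨ sum-cong-≗ (λ x → χ*χ-cong (Orbit? x r) (¬? (Fixed? x)) (¬? (Fixed? r)) (Orbit? r x) swap swap′) ⟩
        ∑[ x < m ] (χ (¬? (Fixed? r)) * χ (Orbit? r x))
          ≡⟨ *-distribˡ-sum (χ (¬? (Fixed? r))) (χ ∘ Orbit? r) ⟨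
        χ (¬? (Fixed? r)) * orbitSize r ∎
        where
        swap : ∀ {x} → Orbit x r × ¬ Fixed x → ¬ Fixed r × Orbit r x
        swap (o , ¬fx) = (λ fr → ¬fx (subst Fixed (orbit-fixed (orbit-sym o) fr) fr)) , orbit-sym o
        swap′ : ∀ {x} → ¬ Fixed r × Orbit r x → Orbit x r × ¬ Fixed x
        swap′ (¬fr , o) = orbit-sym o , λ fx → ¬fr (subst Fixed (orbit-fixed (orbit-sym o) fx) fx)
      by-orbits : count (λ x → X? x ×-dec ¬? (Fixed? x)) ≡
                  ∑[ r < m ] (χ (IsRep? r) * (χ (¬? (Fixed? r)) * orbitSize r))
      by-orbits = begin
        ∑[ x < m ] χ (X? x ×-dec ¬? (Fixed? x))
          ≡⟨ sum-cong-≗ (λ x → trans (χ-× (X? x) (¬? (Fixed? x)))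
                                  (χ*χ-cong (X? x) (¬? (Fixed? x)) (Orbit? x x) (¬? (Fixed? x))
                                     (λ (Xx , ¬fx) → (Xx , ε , act-ε Xx) , ¬fx)
                                     (λ ((Xx , _) , ¬fx) → Xx , ¬fx))) ⟩
        ∑[ x < m ] (χ (Orbit? x x) * χ (¬? (Fixed? x)))
          ≡⟨ ∑-by-classes (χ ∘ ¬? ∘ Fixed?) ⟩
        ∑[ r < m ] (χ (IsRep? r) * ∑[ x < m ] (χ (Orbit? x r) * χ (¬? (Fixed? x))))
          ≡⟨ sum-cong-≗ (λ r → cong (χ (IsRep? r) *_) (nonFixed-orbit r)) ⟩
        ∑[ r < m ] (χ (IsRep? r) * (χ (¬? (Fixed? r)) * orbitSize r)) ∎
      p∣orbit : ∀ r → p ∣ χ (IsRep? r) * (χ (¬? (Fixed? r)) * orbitSize r)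
      p∣orbit r with IsRep? r | Fixed? r
      ... | no _               | _     = p ∣0
      ... | yes _              | yes _ = p ∣0
      ... | yes ((Xr , _) , _) | no ¬fr with p∣divisors (orbitSize∣n Xr)
      ...   | inj₂ p∣orbitSize = ∣n⇒∣m*n 1 (∣n⇒∣m*n 1 p∣orbitSize)
      ...   | inj₁ orbitSize≡1 with ¬∀⟶∃¬ n (λ g → act g r ≡ r) (λ g → act g r ≟ r) ¬fr
      ...     | g , gr≢r = ⊥-elim (ℕ.<-irrefl (sym orbitSize≡1)
                  (2≤count (Orbit? r) (gr≢r ∘ sym) (Xr , ε , act-ε Xr) (Xr , g , refl)))

  module CosetConjugation {ℓ} {N : Pred (Fin n) ℓ} (N? : Decidable N) (N-normal : IsNormalSubgroup group N) where
    open IsNormalSubgroup N-normal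
    open Cosets N? isSubgroup public

    conj-∼ : ∀ g {x y} → x ∼ y → conj g x ∼ conj g y
    conj-∼ g {x} {y} x∼y = subst N eq (conj∈ g x∼y)
      where
      eq : conj g (y ⁻¹ ∙ x) ≡ conj g y ⁻¹ ∙ conj g x
      eq = trans (conj-∙ g (y ⁻¹) x) (cong (_∙ conj g x) (conj-⁻¹ g y))

    act : Fin n → Fin n → Fin n
    act g r = rep (conj g r)

    act-IsRep : ∀ g {r} → IsRep r → IsRep (act g r)
    act-IsRep g _ = rep-IsRep ∼-refl

    act-ε : ∀ {r} → IsRep r → act ε r ≡ r
    act-ε {r} (_ , rep-r≡r) = trans (cong rep (conj-ε r)) rep-r≡r

    act-∙ : ∀ g h {r} → IsRep r → act (g ∙ h) r ≡ act g (act h r)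
    act-∙ g h {r} _ = trans (cong rep (conj-comp g h r)) (rep-cong (conj-∼ g (∼-sym (rep-R ∼-refl))))

    open Action IsRep? act act-IsRep act-ε act-∙ public

  module Order (c : Fin n) where
    open MonoidMultProperties (Group.monoid group) using (×-homo-+)

    private
      OrderAt : Pred (Fin n) 0ℓ
      OrderAt i = c ^ᵍ suc (toℕ i) ≡ ε

      period : ∀ d → 0 < d → d ≤ n → c ^ᵍ d ≡ ε → ∃ OrderAt
      period (suc s) _ s<n c^d≡ε = fromℕ< s<n , subst (λ t → c ^ᵍ suc t ≡ ε) (sym (toℕ-fromℕ< s<n)) c^d≡ε

      -- Abstract because otherwise conversion checking unfolds the pigeonhole search behind
      -- `order`, which is prohibitively slow.
      abstract
        some-period : ∃ OrderAt
        some-period with pigeonhole (ℕ.n<1+n n) (λ (i : Fin (suc n)) → c ^ᵍ toℕ i)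
        ... | i , j , i<j , c^i≡c^j = period (toℕ j ∸ toℕ i) (ℕ.m<n⇒0<n∸m i<j)
                (ℕ.≤-trans (ℕ.m∸n≤m (toℕ j) (toℕ i)) (s≤s⁻¹ (toℕ<n j)))
                (^-cancel (toℕ i) (toℕ j) (ℕ.<⇒≤ i<j) c^i≡c^j)

        least-period : ∃ λ i → OrderAt i × (∀ {j} → OrderAt j → i ≤ᶠ j)
        least-period with some-period
        ... | i , c^[1+i]≡ε = least (λ i → c ^ᵍ suc (toℕ i) ≟ ε) {i} c^[1+i]≡ε

    order : ℕ
    order = suc (toℕ (proj₁ least-period))

    ^order≡ε : c ^ᵍ order ≡ ε
    ^order≡ε = proj₁ (proj₂ least-period)

    order∣ : ∀ {j} → c ^ᵍ j ≡ ε → order ∣ j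
    order∣ {j} c^j≡ε =
      m%n≡0⇒n∣m j order (remainder≡0 (j % order) (m%n<n j order) (trans (sym (^-mod order ^order≡ε j)) c^j≡ε))
      where
      remainder≡0 : ∀ r → r < order → c ^ᵍ r ≡ ε → r ≡ 0
      remainder≡0 zero    _            _     = refl
      remainder≡0 (suc s) (s≤s s<i₀) c^r≡ε =
        ⊥-elim (ℕ.<⇒≱ s<i₀ (ℕ.≤-trans i₀≤s (ℕ.≤-reflexive (toℕ-fromℕ< s<n))))
        where
        s<n : s < n
        s<n = ℕ.<-trans s<i₀ (toℕ<n (proj₁ least-period))
        i₀≤s : proj₁ least-period ≤ᶠ fromℕ< s<n
        i₀≤s = proj₂ (proj₂ least-period) (subst (λ t → c ^ᵍ suc t ≡ ε) (sym (toℕ-fromℕ< s<n)) c^r≡ε)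

    Powers : Pred (Fin n) 0ℓ
    Powers x = ∃ λ (i : Fin order) → c ^ᵍ toℕ i ≡ x

    Powers? : Decidable Powers
    Powers? x = any? (λ i → c ^ᵍ toℕ i ≟ x)

    power∈ : ∀ t → Powers (c ^ᵍ t)
    power∈ t = fromℕ< (m%n<n t order) ,
               trans (cong (c ^ᵍ_) (toℕ-fromℕ< (m%n<n t order))) (sym (^-mod order ^order≡ε t))

    powers-subgroup : IsSubgroup group Powers
    powers-subgroup = record
      { resp = λ { refl P → P }
      ; ε∈   = fzero , refl
      ; ∙∈   = λ { (i , refl) (j , refl) →
                   subst Powers (×-homo-+ c (toℕ i) (toℕ j)) (power∈ (toℕ i + toℕ j)) }
      ; ⁻¹∈  = λ { (i , refl) →
                   subst Powers (sym (^-⁻¹ order ^order≡ε (toℕ i))) (power∈ (toℕ i * pred order)) }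
      }

    private
      no-short-period : ∀ {a b} → a < b → b < order → c ^ᵍ a ≢ c ^ᵍ b
      no-short-period {a} {b} a<b b<order c^a≡c^b =
        ℕ.<⇒≱ (ℕ.≤-<-trans (ℕ.m∸n≤m b a) b<order)
              (∣⇒≤ {{>-nonZero (ℕ.m<n⇒0<n∸m a<b)}} (order∣ (^-cancel a b (ℕ.<⇒≤ a<b) c^a≡c^b)))

    ^-injective : ∀ {i j : Fin order} → c ^ᵍ toℕ i ≡ c ^ᵍ toℕ j → i ≡ j
    ^-injective {i} {j} c^i≡c^j with ℕ.<-cmp (toℕ i) (toℕ j)
    ... | tri≈ _ i≡j _ = toℕ-injective i≡j
    ... | tri< i<j _ _ = ⊥-elim (no-short-period i<j (toℕ<n j) c^i≡c^j)
    ... | tri> _ _ j<i = ⊥-elim (no-short-period j<i (toℕ<n i) (sym c^i≡c^j))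

    order∣n : order ∣ n
    order∣n = divides index (trans lagrange (cong (index *_) (count-image (λ i → c ^ᵍ toℕ i) ^-injective)))
      where open Cosets Powers? powers-subgroup using (index; lagrange)

    ^n≡ε : c ^ᵍ n ≡ ε
    ^n≡ε with order∣n
    ... | divides q n≡q*order = trans (cong (c ^ᵍ_) n≡q*order) (^-* order ^order≡ε q)

-- p-groups

∣p^k⇒≡1⊎p∣ : ∀ {p} → Prime p → ∀ k {d} → d ∣ p ^ k → d ≡ 1 ⊎ p ∣ d
∣p^k⇒≡1⊎p∣ p-prime zero    d∣1 = inj₁ (∣1⇒≡1 d∣1)
∣p^k⇒≡1⊎p∣ {p} p-prime (suc k) {d} d∣p^[1+k] with p ∣? d
... | yes p∣d = inj₂ p∣d
... | no  p∤d = ∣p^k⇒≡1⊎p∣ p-prime k (coprime-divisor d⊥p d∣p^[1+k])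
  where
  d⊥p : Coprime d p
  d⊥p (e∣d , e∣p) with prime⇒irreducible p-prime e∣p
  ... | inj₁ e≡1   = e≡1
  ... | inj₂ ≡.refl = ⊥-elim (p∤d e∣d)

module PGroup {p} (p-prime : Prime p) {k} (G : FinGroup (p ^ k)) where
  open FiniteGroup G
  open ≡ using (refl; sym; trans; cong; subst)
  open IsGroup isGroup using (identityˡ; identityʳ)
  open GroupProperties group using (⁻¹-involutive; ε⁻¹≈ε)
  open GroupTheory group using (centre-normal; central-resp; central-conj; ⁅⁆≈ε⇒commute; conj-⁻¹)

  private
    divisor : ∀ {d} → d ∣ p ^ k → d ≡ 1 ⊎ p ∣ d
    divisor = ∣p^k⇒≡1⊎p∣ p-prime k

    p∤1 : ¬ p ∣ 1
    p∤1 p∣1 = nonTrivial⇒≢1 {{prime⇒nonTrivial p-prime}} (∣1⇒≡1 p∣1)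

  ^≡ε⇒p∣ : ∀ {c j} → c ≢ ε → c ^ᵍ j ≡ ε → p ∣ j
  ^≡ε⇒p∣ {c} c≢ε c^j≡ε with divisor (Order.order∣n c)
  ... | inj₂ p∣order = ∣-trans p∣order (Order.order∣ c c^j≡ε)
  ... | inj₁ order≡1 =
    ⊥-elim (c≢ε (trans (sym (identityʳ c)) (subst (λ t → c ^ᵍ t ≡ ε) order≡1 (Order.^order≡ε c))))

  module NonabelianCentre (nonabelian : ¬ IsAbelian group) where
    open CosetConjugation IsCentral? centre-normal

    central⇒∼ε : ∀ {x} → IsCentral group x → x ∼ ε
    central⇒∼ε {x} x-central = central-resp (sym (trans (cong (_∙ x) ε⁻¹≈ε) (identityˡ x))) x-central

    p∣index : p ∣ index
    p∣index with divisor index∣n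
    ... | inj₂ p∣index = p∣index
    ... | inj₁ index≡1 with ¬∀⟶∃¬ (p ^ k) (IsCentral group) IsCentral? nonabelian
    ...   | a , a-noncentral = ⊥-elim (ℕ.<-irrefl centre-is-everything (count<m IsCentral? a-noncentral))
      where
      centre-is-everything : count IsCentral? ≡ p ^ k
      centre-is-everything = sym (trans lagrange (trans (cong (_* count IsCentral?) index≡1) (ℕ.*-identityˡ _)))

    p∣fixedCosets : p ∣ count (λ r → IsRep? r ×-dec Fixed? r)
    p∣fixedCosets = ∣m+n∣m⇒∣n (subst (p ∣_) split p∣index) (fixed-points divisor)
      where
      split : index ≡ count (λ r → IsRep? r ×-dec ¬? (Fixed? r)) + count (λ r → IsRep? r ×-dec Fixed? r)
      split = trans (count-split IsRep? Fixed?) (ℕ.+-comm (count (λ r → IsRep? r ×-dec Fixed? r)) _)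

    centre-fixed : IsRep (rep ε) × Fixed (rep ε)
    centre-fixed = rep-IsRep ∼-refl , λ g → trans (cong rep (central-conj rep-ε-central g)) (proj₂ (rep-IsRep ∼-refl))
      where
      rep-ε-central : IsCentral group (rep ε)
      rep-ε-central = central-resp (trans (cong (_∙ rep ε) ε⁻¹≈ε) (identityˡ (rep ε))) (rep-R ∼-refl)

    noncentral-fixed-coset : ∃ λ r → Fixed r × ¬ IsCentral group r
    noncentral-fixed-coset with any? (λ r → (IsRep? r ×-dec Fixed? r) ×-dec ¬? (r ≟ rep ε))
    ... | yes (r , ((_ , rep-r≡r) , r-fixed) , r≢rep-ε) =
      r , r-fixed , λ r-central → r≢rep-ε (trans (sym rep-r≡r) (rep-cong (central⇒∼ε r-central)))
    ... | no none = ⊥-elim (p∤1 (subst (p ∣_) only-centre p∣fixedCosets))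
      where
      is-centre : ∀ {r} → IsRep r × Fixed r → rep ε ≡ r
      is-centre {r} fixedRep with r ≟ rep ε
      ... | yes r≡rep-ε = sym r≡rep-ε
      ... | no  r≢rep-ε = ⊥-elim (none (r , fixedRep , r≢rep-ε))
      only-centre : count (λ r → IsRep? r ×-dec Fixed? r) ≡ 1
      only-centre = trans (count-cong _ (rep ε ≟_) is-centre (λ { refl → centre-fixed })) (count-≡ (rep ε))

    central-commutator : ∃₂ λ a b → IsCentral group ⁅ a , b ⁆ × ⁅ a , b ⁆ ≢ ε
    central-commutator with noncentral-fixed-coset
    ... | r , r-fixed , r-noncentral with ¬∀⟶∃¬ (p ^ k) (λ g → r ∙ g ≡ g ∙ r) (λ g → r ∙ g ≟ g ∙ r) r-noncentral
    ...   | g , rg≢gr = g , r , ⁅g,r⁆-central , λ ⁅g,r⁆≡ε → rg≢gr (sym (⁅⁆≈ε⇒commute ⁅g,r⁆≡ε))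
      where
      eq : conj (g ⁻¹) r ⁻¹ ∙ r ≡ ⁅ g , r ⁆
      eq = cong (_∙ r) (trans (sym (conj-⁻¹ (g ⁻¹) r)) (cong ((g ⁻¹ ∙ r ⁻¹) ∙_) (⁻¹-involutive g)))
      ⁅g,r⁆-central : IsCentral group ⁅ g , r ⁆
      ⁅g,r⁆-central = subst (IsCentral group) eq (subst (_∼ conj (g ⁻¹) r) (r-fixed (g ⁻¹)) (rep-R ∼-refl))

  nonabelian⇒central-commutator : ¬ IsAbelian group →
                                  ∃₂ λ a b → IsCentral group ⁅ a , b ⁆ × ⁅ a , b ⁆ ≢ ε
  nonabelian⇒central-commutator = NonabelianCentre.central-commutator

-- Transfer to an abstract group of order p ^ k

module FiniteModel {n} (H : Group a ℓ) (|H|≡n : HasOrder H n) where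
  open Group H
  open Inverse |H|≡n using (to; from; to-cong; strictlyInverseˡ; strictlyInverseʳ)

  rawModel : RawGroup 0ℓ 0ℓ
  rawModel = record
    { Carrier = Fin n
    ; _≈_     = _≡_
    ; _∙_     = λ i j → to (from i ∙ from j)
    ; ε       = to ε
    ; _⁻¹     = λ i → to (from i ⁻¹)
    }

  from-monomorphism : GroupMorphisms.IsGroupMonomorphism rawModel rawGroup from
  from-monomorphism = record
    { isGroupHomomorphism = record
      { isMonoidHomomorphism = record
        { isMagmaHomomorphism = record
          { isRelHomomorphism = record { cong = λ { ≡.refl → refl } }
          ; homo              = λ i j → strictlyInverseʳ (from i ∙ from j)
          }
        ; ε-homo = strictlyInverseʳ ε
        }
      ; ⁻¹-homo = λ i → strictlyInverseʳ (from i ⁻¹)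
      }
    ; injective = λ {i} {j} from-i≈from-j →
        ≡.trans (≡.sym (strictlyInverseˡ i)) (≡.trans (to-cong from-i≈from-j) (strictlyInverseˡ j))
    }

  model : FinGroup n
  model = record { isGroup = GroupMonomorphism.isGroup from-monomorphism isGroup }

module PGroupFacts {p} (p-prime : Prime p) {k} (H : Group a ℓ) (|H|≡p^k : HasOrder H (p ^ k)) where
  open Group H
  open GroupTheory H
  open FiniteModel H |H|≡p^k
  open Inverse |H|≡p^k using (to; from; strictlyInverseʳ)
  open GroupMorphisms.IsGroupMonomorphism from-monomorphism using (isGroupHomomorphism; injective)
  open Homomorphism {G = FinGroup.group model} {K = H} isGroupHomomorphism
  open SetoidReasoning setoid
  private
    module Model  = FiniteGroup model
    module ModelP = PGroup p-prime {k} model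

  from-surjective : Surjective _≡_ _≈_ from
  from-surjective h = to h , λ { ≡.refl → strictlyInverseʳ h }

  from-≈ε : ∀ {i} → from i ≈ ε → i ≡ Model.ε
  from-≈ε from-i≈ε = injective (trans from-i≈ε (sym ε-homo))

  nonabelian⇒central-commutator : ¬ IsAbelian H → ∃₂ λ x y → IsCentral H ⁅ x , y ⁆ × ¬ ⁅ x , y ⁆ ≈ ε
  nonabelian⇒central-commutator H-nonabelian =
    let i , j , ⁅i,j⁆-central , ⁅i,j⁆≢ε =
          ModelP.nonabelian⇒central-commutator (H-nonabelian ∘ abelian-image from-surjective)
    in from i , from j , central-resp (homo-⁅⁆ i j) (central-image from-surjective ⁅i,j⁆-central) ,
       λ ⁅x,y⁆≈ε → ⁅i,j⁆≢ε (from-≈ε (trans (homo-⁅⁆ i j) ⁅x,y⁆≈ε))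

  ^-via-model : ∀ x j → x ^ᵍ j ≈ from (to x Model.^ᵍ j)
  ^-via-model x j = begin
    x ^ᵍ j                   ≈⟨ ^-cong j (strictlyInverseʳ x) ⟨
    from (to x) ^ᵍ j         ≈⟨ homo-^ (to x) j ⟨
    from (to x Model.^ᵍ j)   ∎

  ^-p^k : ∀ x → x ^ᵍ (p ^ k) ≈ ε
  ^-p^k x = begin
    x ^ᵍ (p ^ k)                   ≈⟨ ^-via-model x (p ^ k) ⟩
    from (to x Model.^ᵍ (p ^ k))   ≡⟨ ≡.cong from (Model.Order.^n≡ε (to x)) ⟩
    from Model.ε                   ≈⟨ ε-homo ⟩
    ε                              ∎

  ^≈ε⇒p∣ : ∀ {x j} → ¬ x ≈ ε → x ^ᵍ j ≈ ε → p ∣ j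
  ^≈ε⇒p∣ {x} {j} x≉ε x^j≈ε = ModelP.^≡ε⇒p∣ to-x≢ε (from-≈ε (trans (sym (^-via-model x j)) x^j≈ε))
    where
    to-x≢ε : to x ≢ Model.ε
    to-x≢ε to-x≡ε = x≉ε (trans (sym (strictlyInverseʳ x)) (trans (reflexive (≡.cong from to-x≡ε)) ε-homo))

-- The two normal subgroups of C × H

module _ {g gℓ c cℓ h hℓ} {G : Group g gℓ} {C : Group c cℓ} {H : Group h hℓ} where
  private
    module C  = Group C
    module H  = Group H
    module C′ = GroupTheory C
    module H′ = GroupTheory H

  module DirectProductWitness
    (G≅C×H : G ≅ᴳ (C ×ᴳ H)) (C-abelian : IsAbelian C)
    {p : ℕ} .{{_ : NonZero p}} {t : C.Carrier} (t≉ε : ¬ t C.≈ C.ε) (t^p≈ε : t C′.^ᵍ p C.≈ C.ε)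
    {a b : H.Carrier} (⁅a,b⁆-central : IsCentral H H′.⁅ a , b ⁆)
    (N : ℕ) .{{_ : NonZero N}} (p∣N : p ∣ N) (⁅a,b⁆^N≈ε : H′.⁅ a , b ⁆ H′.^ᵍ N H.≈ H.ε)
    (⁅a,b⁆^j≈ε⇒p∣j : ∀ {j} → H′.⁅ a , b ⁆ H′.^ᵍ j H.≈ H.ε → p ∣ j)
    where

    open Group G
    open GroupTheory G
    open GroupProperties G using (y≈x\\z)
    open GroupMorphisms.IsGroupIsomorphism (proj₂ G≅C×H) using (isGroupHomomorphism; injective; surjective)
    open DirectProductProjections {G = G} {K₁ = C} {K₂ = H} isGroupHomomorphism using (proj₁-homo; proj₂-homo)
    module π₁ = Homomorphism {G = G} {K = C} proj₁-homo
    module π₂ = Homomorphism {G = G} {K = H} proj₂-homo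

    π₁ : Carrier → C.Carrier
    π₁ = proj₁ ∘ proj₁ G≅C×H

    π₂ : Carrier → H.Carrier
    π₂ = proj₂ ∘ proj₁ G≅C×H

    ≈-from-components : ∀ {x y} → π₁ x C.≈ π₁ y → π₂ x H.≈ π₂ y → x ≈ y
    ≈-from-components π₁x≈π₁y π₂x≈π₂y = injective (π₁x≈π₁y , π₂x≈π₂y)

    ≈ε-from-components : ∀ {x} → π₁ x C.≈ C.ε → π₂ x H.≈ H.ε → x ≈ ε
    ≈ε-from-components π₁x≈ε π₂x≈ε =
      ≈-from-components (C.trans π₁x≈ε (C.sym π₁.ε-homo)) (H.trans π₂x≈ε (H.sym π₂.ε-homo))

    central-from-components : ∀ {x} → IsCentral C (π₁ x) → IsCentral H (π₂ x) → IsCentral G x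
    central-from-components π₁x-central π₂x-central y =
      ≈-from-components (π₁.homo-swap (π₁x-central (π₁ y))) (π₂.homo-swap (π₂x-central (π₂ y)))

    with-components : ∀ x y → ∃ λ z → π₁ z C.≈ x × π₂ z H.≈ y
    with-components x y with surjective (x , y)
    ... | z , fz≈xy = z , fz≈xy refl

    -- u = (t, ε), z = ⁅(ε, a), (ε, b)⁆ ≈ (ε, ⁅a,b⁆) and w = z ∙ u ≈ (t, ⁅a,b⁆).
    a′ b′ u z w : Carrier
    a′ = proj₁ (with-components C.ε a)
    b′ = proj₁ (with-components C.ε b)
    u  = proj₁ (with-components t H.ε)
    z  = ⁅ a′ , b′ ⁆
    w  = z ∙ u

    π₁u≈t : π₁ u C.≈ t
    π₁u≈t = proj₁ (proj₂ (with-components t H.ε))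

    π₂u≈ε : π₂ u H.≈ H.ε
    π₂u≈ε = proj₂ (proj₂ (with-components t H.ε))

    π₁w≈t : π₁ w C.≈ t
    π₁w≈t = begin
      π₁ (z ∙ u)      ≈⟨ π₁.∙-homo z u ⟩
      π₁ z C.∙ π₁ u   ≈⟨ C.∙-cong (π₁.Der⊆kernel C-abelian (comm _ _)) π₁u≈t ⟩
      C.ε C.∙ t       ≈⟨ C.identityˡ t ⟩
      t               ∎
      where open SetoidReasoning C.setoid

    π₂w≈⁅a,b⁆ : π₂ w H.≈ H′.⁅ a , b ⁆
    π₂w≈⁅a,b⁆ = begin
      π₂ (z ∙ u)                    ≈⟨ π₂.∙-homo z u ⟩
      π₂ z H.∙ π₂ u                 ≈⟨ H.∙-cong (π₂.homo-⁅⁆ a′ b′) π₂u≈ε ⟩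
      H′.⁅ π₂ a′ , π₂ b′ ⁆ H.∙ H.ε  ≈⟨ H.identityʳ _ ⟩
      H′.⁅ π₂ a′ , π₂ b′ ⁆
        ≈⟨ H′.⁅⁆-cong (proj₂ (proj₂ (with-components C.ε a))) (proj₂ (proj₂ (with-components C.ε b))) ⟩
      H′.⁅ a , b ⁆                  ∎
      where open SetoidReasoning H.setoid

    t^j≈ε : ∀ {j} → p ∣ j → t C′.^ᵍ j C.≈ C.ε
    t^j≈ε (divides q ≡.refl) = C′.^-* p t^p≈ε q

    u-central : IsCentral G u
    u-central = central-from-components (C-abelian (π₁ u)) (H′.central-resp (H.sym π₂u≈ε) H′.ε-central)

    w-central : IsCentral G w
    w-central = central-from-components (C-abelian (π₁ w)) (H′.central-resp (H.sym π₂w≈⁅a,b⁆) ⁅a,b⁆-central)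

    u^p≈ε : u ^ᵍ p ≈ ε
    u^p≈ε = ≈ε-from-components (C.trans (π₁.homo-^-≈ p π₁u≈t) t^p≈ε)
                               (H.trans (π₂.homo-^-≈ p π₂u≈ε) (H′.ε^ p))

    w^N≈ε : w ^ᵍ N ≈ ε
    w^N≈ε = ≈ε-from-components (C.trans (π₁.homo-^-≈ N π₁w≈t) (t^j≈ε p∣N))
                               (H.trans (π₂.homo-^-≈ N π₂w≈⁅a,b⁆) ⁅a,b⁆^N≈ε)

    ⟨u⟩∩⟨w⟩-trivial : TrivialIntersection G ⟨ u ⟩ ⟨ w ⟩
    ⟨u⟩∩⟨w⟩-trivial x (lift (i , x≈u^i)) (lift (j , x≈w^j)) = ≈ε-from-components π₁x≈ε π₂x≈ε
      where
      π₂x≈ε : π₂ x H.≈ H.ε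
      π₂x≈ε = H.trans (π₂.⟦⟧-cong x≈u^i) (H.trans (π₂.homo-^-≈ i π₂u≈ε) (H′.ε^ i))
      p∣j : p ∣ j
      p∣j = ⁅a,b⁆^j≈ε⇒p∣j (H.trans (H.sym (π₂.homo-^-≈ j π₂w≈⁅a,b⁆))
                                     (H.trans (H.sym (π₂.⟦⟧-cong x≈w^j)) π₂x≈ε))
      π₁x≈ε : π₁ x C.≈ C.ε
      π₁x≈ε = C.trans (π₁.⟦⟧-cong x≈w^j) (C.trans (π₁.homo-^-≈ j π₁w≈t) (t^j≈ε p∣j))

    u∉Der : ¬ Der G u
    u∉Der u∈Der = t≉ε (C.trans (C.sym π₁u≈t) (π₁.Der⊆kernel C-abelian u∈Der))

    u∈Der·⟨u⟩ : _·_ G (Der G) ⟨ u ⟩ u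
    u∈Der·⟨u⟩ = ε , u , one , lift (1 , sym (identityʳ u)) , sym (identityˡ u)

    u∈Der·⟨w⟩ : _·_ G (Der G) ⟨ w ⟩ u
    u∈Der·⟨w⟩ = z ⁻¹ , w , inv (comm _ _) , lift (1 , sym (identityʳ w)) , y≈x\\z z u w refl

    witness : Σ (Pred Carrier (g ⊔ gℓ)) λ G1 → Σ (Pred Carrier (g ⊔ gℓ)) λ G2 →
      IsNormalSubgroup G G1 × IsNormalSubgroup G G2 × TrivialIntersection G G1 G2 ×
      ¬ SameSubset G (_·_ G (Der G) G1 ∩ _·_ G (Der G) G2) (Der G)
    witness = ⟨ u ⟩ , ⟨ w ⟩ , ⟨⟩-normal u-central p u^p≈ε , ⟨⟩-normal w-central N w^N≈ε ,
              ⟨u⟩∩⟨w⟩-trivial ,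
              λ same → u∉Der (proj₁ (same u) (u∈Der·⟨u⟩ , u∈Der·⟨w⟩))

-- ℤ/pℤ and the theorem

module _ (p : ℕ) where
  private
    module ℤ/p = Group (ℤmod p)
    module ℤ/p′ = GroupTheory (ℤmod p)

  ℤmod-abelian : IsAbelian (ℤmod p)
  ℤmod-abelian x y = ℤ/p.reflexive (ℤ.+-comm x y)

  +1^k≡+k : ∀ k → (+ 1) ℤ/p′.^ᵍ k ≡ + k
  +1^k≡+k zero    = ≡.refl
  +1^k≡+k (suc k) = ≡.cong (λ n → + 1 ℤ/p.∙ n) (+1^k≡+k k)

  +1^p≈0 : (+ 1) ℤ/p′.^ᵍ p ℤ/p.≈ 0ℤ
  +1^p≈0 = ℤ/p.trans {(+ 1) ℤ/p′.^ᵍ p} {+ p} {0ℤ} (ℤ/p.reflexive (+1^k≡+k p))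
                     (≡.subst (+ p ∣ℤ_) (≡.sym (ℤ.+-identityʳ (+ p))) ∣ℤ-refl)

  +1≉0 : .{{_ : NonTrivial p}} → ¬ + 1 ℤ/p.≈ 0ℤ
  +1≉0 p∣1 = nonTrivial⇒≢1 (∣1⇒≡1 (∣⇒∣ᵤ p∣1))

mainTheorem15 : ∀ {c ℓ g gℓ} (p : ℕ) → Prime p →
    (H : Group c ℓ) → HasOrder H (p ^ 3) → ¬ IsAbelian H →
    (G : Group g gℓ) → G ≅ᴳ (ℤmod p ×ᴳ H) →
    Σ (Pred (Group.Carrier G) (g ⊔ gℓ)) λ G1 →
    Σ (Pred (Group.Carrier G) (g ⊔ gℓ)) λ G2 →
      IsNormalSubgroup G G1 × IsNormalSubgroup G G2 ×
      TrivialIntersection G G1 G2 ×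
      ¬ SameSubset G (_·_ G (Der G) G1 ∩ _·_ G (Der G) G2) (Der G)
mainTheorem15 p p-prime H |H|≡p³ H-nonabelian G G≅ℤ/p×H =
  let a , b , ⁅a,b⁆-central , ⁅a,b⁆≉ε = nonabelian⇒central-commutator H-nonabelian
  in DirectProductWitness.witness {G = G} {C = ℤmod p} {H = H} G≅ℤ/p×H
       (ℤmod-abelian p) (+1≉0 p) (+1^p≈0 p)
       ⁅a,b⁆-central (p ^ 3) (m∣m*n (p ^ 2)) (^-p^k (GroupTheory.⁅_,_⁆ H a b)) (^≈ε⇒p∣ ⁅a,b⁆≉ε)
  where
  open PGroupFacts p-prime {3} H |H|≡p³
  instance
    p-nonZero : NonZero p
    p-nonZero = prime⇒nonZero p-prime
    p-nonTrivial : NonTrivial p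
    p-nonTrivial = prime⇒nonTrivial p-prime
    p³-nonZero : NonZero (p ^ 3)
    p³-nonZero = ℕ.m^n≢0 p 3
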